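{- Let $G$ be a finite simple graph, $A_1,A_2$ disjoint subsets of $V(G)$, and $G^*$ the graph obtained by toggling all pairs between $A_1$ and $A_2$, with closed neighborhood matrices $N$ and $N^*$. Suppose $A_1$ is an NO set and $A_2$ is an AO set in $G$, and $A_2$ is $\overline{\mathbf{x}_{A_1}}$-AO in $G$. Then for every pattern $\mathbf{p}$, $N^*\mathbf{p}=\mathbf{1}$ if and only if $N\mathbf{p}=\overline{\mathbf{x}_{A_1}}$. Moreover, $A_1$ is NO and $A_2$ is AO in $G^*$, and $\nu(G^*)=\nu(G)$.
   Context: For a graph $H$ with vertex set $V=\{v_1,\dots,v_n\}$, $N(H)$ is the closed neighborhood matrix over $\mathbb{Z}_2$ (entry $(i,j)$ is $1$ iff $i=j$ or $v_iv_j$ is an edge), $\nu(H)=\dim\ker N(H)$. Given disjoint $A_1,A_2\subseteq V(G)$, $G^*$ is obtained from $G$ by, for every $u\in A_1$, $v\in A_2$, adding the edge $uv$ if $u,v$ are non-adjacent and removing it if they are adjacent; $N=N(G)$, $N^*=N(G^*)$. Subsets $A$ are identified with characteristic vectors $\mathbf{x}_A$; $\mathbf{x}\cdot\mathbf{y}=\mathbf{x}^t\mathbf{y}$ over $\mathbb{Z}_2$; $\mathbf{1}$ is the all-ones vector, $\overline{\mathbf{x}}:=\mathbf{x}+\mathbf{1}$. In a graph $H$ with matrix $M$: a pattern $\mathbf{p}$ solves configuration $\mathbf{c}$ if $M\mathbf{p}=\mathbf{c}$; $\mathbf{c}$ (or a set $A$ via $\mathbf{x}_A$) is solvable if some pattern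 solves it; $\mathbf{1}$ is always solvable. A set $A$ is HO if it is not solvable. For solvable $A$ and solvable $\mathbf{c}$, $A$ is $\mathbf{c}$-AO if $\mathbf{x}_A\cdot\mathbf{p}=1$ for all solving patterns $\mathbf{p}$ of $\mathbf{c}$, and $\mathbf{c}$-NO if $\mathbf{x}_A\cdot\mathbf{p}=0$ for all of them; AO and NO mean $\mathbf{1}$-AO and $\mathbf{1}$-NO. -}

module Defs where

open import Data.Nat using (ℕ; zero; suc; _+_)
open import Data.Nat.Logarithm using (⌊log₂_⌋)
open import Data.Bool using (Bool; true; false; _∧_; _∨_; _xor_; not; if_then_else_)
open import Data.Fin using (Fin; zero; suc; _≟_)
open import Data.Product using (Σ; _×_)
open import Relation.Binary.PropositionalEquality using (_≡_; _≢_)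
open import Relation.Nullary using (¬_)
open import Relation.Nullary.Decidable using (⌊_⌋)

Vec₂ : ℕ → Set
Vec₂ n = Fin n → Bool

Mat₂ : ℕ → Set
Mat₂ n = Fin n → Fin n → Bool

record Graph (n : ℕ) : Set where
  field
    adj   : Fin n → Fin n → Bool
    sym   : ∀ i j → adj i j ≡ adj j i
    irrefl : ∀ i → adj i i ≡ false
open Graph public

Σ₂ : ∀ {n} → (Fin n → Bool) → Bool
Σ₂ {zero}  f = false
Σ₂ {suc n} f = f zero xor Σ₂ (λ i → f (suc i))

_·_ : ∀ {n} → Vec₂ n → Vec₂ n → Bool
x · y = Σ₂ (λ i → x i ∧ y i)

_⊛_ : ∀ {n} → Mat₂ n → Vec₂ n → Vec₂ n
(M ⊛ p) i = Σ₂ (λ j → M i j ∧ p j)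

𝟏 : ∀ {n} → Vec₂ n
𝟏 _ = true

compl : ∀ {n} → Vec₂ n → Vec₂ n
compl x i = x i xor true

N : ∀ {n} → Graph n → Mat₂ n
N H i j = ⌊ i ≟ j ⌋ ∨ adj H i j

-- Disjointness of subsets (as characteristic vectors).
Disjoint : ∀ {n} → Vec₂ n → Vec₂ n → Set
Disjoint A B = ∀ i → A i ∧ B i ≡ false

toggleAdj : ∀ {n} → Graph n → Vec₂ n → Vec₂ n → Fin n → Fin n → Bool
toggleAdj G A₁ A₂ u v = adj G u v xor ((A₁ u ∧ A₂ v) ∨ (A₂ u ∧ A₁ v))

toggle : ∀ {n} (G : Graph n) (A₁ A₂ : Vec₂ n) → Disjoint A₁ A₂ → Graph n
toggle {n} G A₁ A₂ d = record { adj = toggleAdj G A₁ A₂ ; sym = s ; irrefl = ir }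
  where
  ∧-comm : ∀ a b → a ∧ b ≡ b ∧ a
  ∧-comm false false = _≡_.refl
  ∧-comm false true  = _≡_.refl
  ∧-comm true  false = _≡_.refl
  ∧-comm true  true  = _≡_.refl
  ∨-comm : ∀ a b → a ∨ b ≡ b ∨ a
  ∨-comm false false = _≡_.refl
  ∨-comm false true  = _≡_.refl
  ∨-comm true  false = _≡_.refl
  ∨-comm true  true  = _≡_.refl
  s : ∀ i j → toggleAdj G A₁ A₂ i j ≡ toggleAdj G A₁ A₂ j i
  s i j rewrite sym G i j | ∧-comm (A₁ i) (A₂ j) | ∧-comm (A₂ i) (A₁ j)
              | ∨-comm (A₂ j ∧ A₁ i) (A₁ j ∧ A₂ i) = _≡_.refl
  ir : ∀ i → toggleAdj G A₁ A₂ i i ≡ false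
  ir i rewrite irrefl G i | d i | ∧-comm (A₂ i) (A₁ i) | d i = _≡_.refl

Solves : ∀ {n} → Graph n → Vec₂ n → Vec₂ n → Set
Solves H p c = ∀ i → (N H ⊛ p) i ≡ c i

Solvable : ∀ {n} → Graph n → Vec₂ n → Set
Solvable {n} H c = Σ (Vec₂ n) (λ p → Solves H p c)

IsAO[_] : ∀ {n} → Graph n → Vec₂ n → Vec₂ n → Set
IsAO[_] {n} H c A = Solvable H A × Solvable H c × (∀ (p : Vec₂ n) → Solves H p c → A · p ≡ true)

IsNO[_] : ∀ {n} → Graph n → Vec₂ n → Vec₂ n → Set
IsNO[_] {n} H c A = Solvable H A × Solvable H c × (∀ (p : Vec₂ n) → Solves H p c → A · p ≡ false)

IsAO : ∀ {n} → Graph n → Vec₂ n → Set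
IsAO H = IsAO[ H ] 𝟏

IsNO : ∀ {n} → Graph n → Vec₂ n → Set
IsNO H = IsNO[ H ] 𝟏

allVecs : (n : ℕ) → (Vec₂ n → ℕ) → ℕ
allVecs zero    f = f (λ ())
allVecs (suc n) f = allVecs n (λ v → f (cons false v)) + allVecs n (λ v → f (cons true v))
  where
  cons : Bool → Vec₂ n → Vec₂ (suc n)
  cons b v zero    = b
  cons b v (suc i) = v i

isZero : ∀ {n} → Vec₂ n → Bool
isZero {zero}  v = true
isZero {suc n} v = not (v zero) ∧ isZero (λ i → v (suc i))

kerSize : ∀ {n} → Graph n → ℕ
kerSize {n} H = allVecs n (λ p → if isZero (N H ⊛ p) then 1 else 0)

-- ν(H) = dim ker N(H) over Z₂ = log₂ |ker N(H)| (the kernel is a subspace,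
-- so its size is exactly 2^dim).
ν : ∀ {n} → Graph n → ℕ
ν H = ⌊log₂ kerSize H ⌋

-- Over Z₂, toggling the pairs between the disjoint sets A₁ and A₂ adds A₁A₂ᵗ + A₂A₁ᵗ to N, so
-- N* p = N p + (A₂ · p) A₁ + (A₁ · p) A₂. Write A₁ = N q₁ and A₂ = N q₂. As N is symmetric,
-- Aₖ · p = qₖ · N p, and as it also has unit diagonal, q · N q = q · 𝟏; with the NO/AO hypotheses
-- this gives q₁ · A₁ = q₁ · A₂ = q₂ · A₁ = 0 and q₂ · A₂ = 1. These values determine the correction
-- term: whenever q₁ · c = 0, N* p = c iff N p = c + (q₂ · c) A₁. The cases c = 𝟏, 𝟎, A₁, A₂ give the
-- correspondence of solutions, equal kernels, and the solving patterns q₁ of A₁ and q₂ + q₁ of A₂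
-- in G*.
{-# OPTIONS --safe #-}
module Submission where

open import Defs hiding (sym)
open import Algebra.Bundles using (CommutativeRing)
open import Data.Bool using (Bool; true; false; not; _∧_; _∨_; _xor_; if_then_else_)
open import Data.Bool.Properties
  using ( xor-∧-commutativeRing; ∧-comm; ∧-assoc; ∧-zeroʳ; ∧-identityʳ; ∧-idem
        ; ∧-distribˡ-xor; ∧-distribʳ-xor; xor-assoc; xor-comm; xor-same; xor-identityʳ
        ; not-injective; ⇔→≡ )
open import Data.Fin using (Fin; zero; suc; _≟_)
open import Data.Nat using (ℕ; zero; suc; _+_)
open import Data.Nat.Logarithm using (⌊log₂_⌋)
open import Data.Product using (_×_; _,_)
open import Function using (_∘_)
open import Function.Bundles using (_⇔_; mk⇔; Equivalence)
import Function.Properties.Equivalence as ⇔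
open import Relation.Binary.PropositionalEquality
  using (_≡_; _≗_; refl; sym; trans; cong; cong₂; subst₂; module ≡-Reasoning)
open import Relation.Nullary.Decidable using (⌊_⌋; yes; no; isYes≗does; dec-true)
open import Relation.Nullary.Negation using (contradiction)

open CommutativeRing xor-∧-commutativeRing using (semiring; *-commutativeSemigroup)
open import Algebra.Properties.Semiring.Sum semiring
  using (sum; sum-cong-≗; ∑-distrib-+; ∑-comm; *-distribˡ-sum)
open import Algebra.Properties.CommutativeSemigroup *-commutativeSemigroup
  using (interchange; x∙yz≈y∙xz; x∙yz≈z∙yx)

open Equivalence using (to; from)
open ≡-Reasoning

private variable
  n : ℕ

∨≡xor : ∀ x y → x ∧ y ≡ false → x ∨ y ≡ x xor y
∨≡xor true  true  ()
∨≡xor true  false _ = refl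
∨≡xor false _     _ = refl

xor-swapped-self : ∀ x y → (x ∧ y) xor (y ∧ x) ≡ false
xor-swapped-self x y = trans (cong ((x ∧ y) xor_) (∧-comm y x)) (xor-same (x ∧ y))

xor-cancelʳ : ∀ x y → (x xor y) xor y ≡ x
xor-cancelʳ x y = trans (xor-assoc x y y) (trans (cong (x xor_) (xor-same y)) (xor-identityʳ x))

xor-moveʳ : ∀ {x y z} → x xor y ≡ z → x ≡ z xor y
xor-moveʳ {x} {y} e = trans (sym (xor-cancelʳ x y)) (cong (_xor y) e)

xor-cancel-middle : ∀ a b c → (a xor b) xor (b xor c) ≡ a xor c
xor-cancel-middle a b c = begin
  (a xor b) xor (b xor c) ≡⟨ xor-assoc a b (b xor c) ⟩
  a xor (b xor (b xor c)) ≡⟨ cong (a xor_) (sym (xor-assoc b b c)) ⟩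
  a xor ((b xor b) xor c) ≡⟨ cong (λ x → a xor (x xor c)) (xor-same b) ⟩
  a xor c                 ∎

Σ₂≡sum : (f : Fin n → Bool) → Σ₂ f ≡ sum f
Σ₂≡sum {zero}  f = refl
Σ₂≡sum {suc n} f = cong (f zero xor_) (Σ₂≡sum (f ∘ suc))

Σ₂-cong : {f g : Fin n → Bool} → f ≗ g → Σ₂ f ≡ Σ₂ g
Σ₂-cong {f = f} {g} f≗g = trans (Σ₂≡sum f) (trans (sum-cong-≗ f≗g) (sym (Σ₂≡sum g)))

Σ₂-xor : (f g : Fin n → Bool) → Σ₂ (λ i → f i xor g i) ≡ Σ₂ f xor Σ₂ g
Σ₂-xor f g = begin
  Σ₂ (λ i → f i xor g i) ≡⟨ Σ₂≡sum (λ i → f i xor g i) ⟩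
  sum (λ i → f i xor g i) ≡⟨ ∑-distrib-+ f g ⟩
  sum f xor sum g        ≡⟨ sym (cong₂ _xor_ (Σ₂≡sum f) (Σ₂≡sum g)) ⟩
  Σ₂ f xor Σ₂ g          ∎

∧-distribˡ-Σ₂ : (b : Bool) (f : Fin n → Bool) → b ∧ Σ₂ f ≡ Σ₂ (λ i → b ∧ f i)
∧-distribˡ-Σ₂ b f = begin
  b ∧ Σ₂ f               ≡⟨ cong (b ∧_) (Σ₂≡sum f) ⟩
  b ∧ sum f              ≡⟨ *-distribˡ-sum b f ⟩
  sum (λ i → b ∧ f i)    ≡⟨ sym (Σ₂≡sum (λ i → b ∧ f i)) ⟩
  Σ₂ (λ i → b ∧ f i)     ∎

Σ₂-comm : (f : Fin n → Fin n → Bool) →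
          Σ₂ (λ i → Σ₂ (λ j → f i j)) ≡ Σ₂ (λ j → Σ₂ (λ i → f i j))
Σ₂-comm f = begin
  Σ₂ (λ i → Σ₂ (f i))               ≡⟨ Σ₂-cong (λ i → Σ₂≡sum (f i)) ⟩
  Σ₂ (λ i → sum (f i))              ≡⟨ Σ₂≡sum (λ i → sum (f i)) ⟩
  sum (λ i → sum (f i))             ≡⟨ ∑-comm f ⟩
  sum (λ j → sum (λ i → f i j))     ≡⟨ sym (Σ₂≡sum (λ j → sum (λ i → f i j))) ⟩
  Σ₂ (λ j → sum (λ i → f i j))      ≡⟨ sym (Σ₂-cong (λ j → Σ₂≡sum (λ i → f i j))) ⟩
  Σ₂ (λ j → Σ₂ (λ i → f i j))       ∎

Σ₂-false : Σ₂ {n} (λ _ → false) ≡ false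
Σ₂-false {zero}  = refl
Σ₂-false {suc n} = Σ₂-false {n}

-- In characteristic 2 the off-diagonal terms f i j and f j i of a symmetric double sum cancel.
Σ₂-symmetric : (f : Fin n → Fin n → Bool) → (∀ i j → f i j ≡ f j i) →
               Σ₂ (λ i → Σ₂ (f i)) ≡ Σ₂ (λ i → f i i)
Σ₂-symmetric {zero}  f f-sym = refl
Σ₂-symmetric {suc n} f f-sym = begin
  (f₀₀ xor row) xor Σ₂ (λ i → f (suc i) zero xor Σ₂ (f′ i))
    ≡⟨ cong ((f₀₀ xor row) xor_) (Σ₂-xor (λ i → f (suc i) zero) (Σ₂ ∘ f′)) ⟩
  (f₀₀ xor row) xor (column xor rest)
    ≡⟨ cong (λ x → (f₀₀ xor x) xor (column xor rest)) row≡column ⟩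
  (f₀₀ xor column) xor (column xor rest)
    ≡⟨ xor-cancel-middle f₀₀ column rest ⟩
  f₀₀ xor rest
    ≡⟨ cong (f₀₀ xor_) (Σ₂-symmetric f′ (λ i j → f-sym (suc i) (suc j))) ⟩
  f₀₀ xor Σ₂ (λ i → f′ i i)
    ∎
  where
  f₀₀ : Bool
  f₀₀ = f zero zero
  f′ : Fin n → Fin n → Bool
  f′ i j = f (suc i) (suc j)
  row column rest : Bool
  row = Σ₂ (λ j → f zero (suc j))
  column = Σ₂ (λ i → f (suc i) zero)
  rest = Σ₂ (λ i → Σ₂ (f′ i))
  row≡column : row ≡ column
  row≡column = Σ₂-cong (λ j → f-sym zero (suc j))

𝟎 : Vec₂ n
𝟎 _ = false

infixl 6 _⊕_
infixr 7 _*ᵥ_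

_⊕_ : Vec₂ n → Vec₂ n → Vec₂ n
(x ⊕ y) i = x i xor y i

_*ᵥ_ : Bool → Vec₂ n → Vec₂ n
(b *ᵥ x) i = b ∧ x i

·-cong : {x x′ y y′ : Vec₂ n} → x ≗ x′ → y ≗ y′ → x · y ≡ x′ · y′
·-cong x≗x′ y≗y′ = Σ₂-cong (λ i → cong₂ _∧_ (x≗x′ i) (y≗y′ i))

·-comm : (x y : Vec₂ n) → x · y ≡ y · x
·-comm x y = Σ₂-cong (λ i → ∧-comm (x i) (y i))

·-zeroʳ : (x : Vec₂ n) → x · 𝟎 ≡ false
·-zeroʳ {n} x = trans (Σ₂-cong (λ i → ∧-zeroʳ (x i))) (Σ₂-false {n})

·-distribˡ-⊕ : (x y z : Vec₂ n) → x · (y ⊕ z) ≡ (x · y) xor (x · z)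
·-distribˡ-⊕ x y z = trans (Σ₂-cong (λ i → ∧-distribˡ-xor (x i) (y i) (z i)))
                           (Σ₂-xor (λ i → x i ∧ y i) (λ i → x i ∧ z i))

·-*ᵥʳ : (x : Vec₂ n) (b : Bool) (y : Vec₂ n) → x · (b *ᵥ y) ≡ b ∧ (x · y)
·-*ᵥʳ x b y =
  trans (Σ₂-cong (λ i → x∙yz≈y∙xz (x i) b (y i))) (sym (∧-distribˡ-Σ₂ b (λ i → x i ∧ y i)))

·-linear : (x c : Vec₂ n) (β : Bool) (u : Vec₂ n) (α : Bool) (v : Vec₂ n) →
           x · (c ⊕ (β *ᵥ u ⊕ α *ᵥ v)) ≡ (x · c) xor ((β ∧ (x · u)) xor (α ∧ (x · v)))
·-linear x c β u α v = begin
  x · (c ⊕ (β *ᵥ u ⊕ α *ᵥ v))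
    ≡⟨ ·-distribˡ-⊕ x c _ ⟩
  (x · c) xor (x · (β *ᵥ u ⊕ α *ᵥ v))
    ≡⟨ cong ((x · c) xor_) (·-distribˡ-⊕ x _ _) ⟩
  (x · c) xor ((x · (β *ᵥ u)) xor (x · (α *ᵥ v)))
    ≡⟨ cong ((x · c) xor_) (cong₂ _xor_ (·-*ᵥʳ x β u) (·-*ᵥʳ x α v)) ⟩
  (x · c) xor ((β ∧ (x · u)) xor (α ∧ (x · v)))
    ∎

infixl 6 _⊞_

_⊞_ : Mat₂ n → Mat₂ n → Mat₂ n
(M ⊞ M′) i j = M i j xor M′ i j

_⊗_ : Vec₂ n → Vec₂ n → Mat₂ n
(x ⊗ y) i j = x i ∧ y j

IsSymmetric : Mat₂ n → Set
IsSymmetric M = ∀ i j → M i j ≡ M j i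

⊛-congˡ : {M M′ : Mat₂ n} → (∀ i j → M i j ≡ M′ i j) → (p : Vec₂ n) → M ⊛ p ≗ M′ ⊛ p
⊛-congˡ M≡M′ p i = Σ₂-cong (λ j → cong (_∧ p j) (M≡M′ i j))

⊛-distribˡ-⊕ : (M : Mat₂ n) (u v : Vec₂ n) → M ⊛ (u ⊕ v) ≗ M ⊛ u ⊕ M ⊛ v
⊛-distribˡ-⊕ M u v i = ·-distribˡ-⊕ (M i) u v

⊞-⊛ : (M M′ : Mat₂ n) (p : Vec₂ n) → (M ⊞ M′) ⊛ p ≗ M ⊛ p ⊕ M′ ⊛ p
⊞-⊛ M M′ p i = trans (Σ₂-cong (λ j → ∧-distribʳ-xor (p j) (M i j) (M′ i j)))
                     (Σ₂-xor (λ j → M i j ∧ p j) (λ j → M′ i j ∧ p j))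

⊗-⊛ : (x y p : Vec₂ n) → (x ⊗ y) ⊛ p ≗ (y · p) *ᵥ x
⊗-⊛ x y p i = begin
  Σ₂ (λ j → (x i ∧ y j) ∧ p j) ≡⟨ Σ₂-cong (λ j → ∧-assoc (x i) (y j) (p j)) ⟩
  Σ₂ (λ j → x i ∧ (y j ∧ p j)) ≡⟨ sym (∧-distribˡ-Σ₂ (x i) (λ j → y j ∧ p j)) ⟩
  x i ∧ (y · p)                ≡⟨ ∧-comm (x i) (y · p) ⟩
  (y · p) ∧ x i                ∎

⊛-adjoint : (M : Mat₂ n) → IsSymmetric M → (q p : Vec₂ n) → (M ⊛ q) · p ≡ q · (M ⊛ p)
⊛-adjoint M M-sym q p = begin
  Σ₂ (λ i → (M ⊛ q) i ∧ p i)
    ≡⟨ Σ₂-cong (λ i → ∧-comm _ (p i)) ⟩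
  Σ₂ (λ i → p i ∧ (M ⊛ q) i)
    ≡⟨ Σ₂-cong (λ i → ∧-distribˡ-Σ₂ (p i) (λ j → M i j ∧ q j)) ⟩
  Σ₂ (λ i → Σ₂ (λ j → p i ∧ (M i j ∧ q j)))
    ≡⟨ Σ₂-comm (λ i j → p i ∧ (M i j ∧ q j)) ⟩
  Σ₂ (λ j → Σ₂ (λ i → p i ∧ (M i j ∧ q j)))
    ≡⟨ Σ₂-cong (λ j → Σ₂-cong (λ i → swap i j)) ⟩
  Σ₂ (λ j → Σ₂ (λ i → q j ∧ (M j i ∧ p i)))
    ≡⟨ sym (Σ₂-cong (λ j → ∧-distribˡ-Σ₂ (q j) (λ i → M j i ∧ p i))) ⟩
  Σ₂ (λ j → q j ∧ (M ⊛ p) j)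
    ∎
  where
  swap : ∀ i j → p i ∧ (M i j ∧ q j) ≡ q j ∧ (M j i ∧ p i)
  swap i j = trans (x∙yz≈z∙yx (p i) (M i j) (q j)) (cong (λ m → q j ∧ (m ∧ p i)) (M-sym i j))

·-⊛-self : (M : Mat₂ n) → IsSymmetric M → (∀ i → M i i ≡ true) → (q : Vec₂ n) → q · (M ⊛ q) ≡ q · 𝟏
·-⊛-self M M-sym M-diag q = begin
  Σ₂ (λ i → q i ∧ (M ⊛ q) i)
    ≡⟨ Σ₂-cong (λ i → ∧-distribˡ-Σ₂ (q i) (λ j → M i j ∧ q j)) ⟩
  Σ₂ (λ i → Σ₂ (λ j → q i ∧ (M i j ∧ q j)))
    ≡⟨ Σ₂-symmetric (λ i j → q i ∧ (M i j ∧ q j)) swap ⟩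
  Σ₂ (λ i → q i ∧ (M i i ∧ q i))
    ≡⟨ Σ₂-cong diagonal ⟩
  Σ₂ (λ i → q i ∧ true)
    ∎
  where
  swap : ∀ i j → q i ∧ (M i j ∧ q j) ≡ q j ∧ (M j i ∧ q i)
  swap i j = trans (x∙yz≈z∙yx (q i) (M i j) (q j)) (cong (λ m → q j ∧ (m ∧ q i)) (M-sym i j))
  diagonal : ∀ i → q i ∧ (M i i ∧ q i) ≡ q i ∧ true
  diagonal i = begin
    q i ∧ (M i i ∧ q i) ≡⟨ cong (λ m → q i ∧ (m ∧ q i)) (M-diag i) ⟩
    q i ∧ q i           ≡⟨ ∧-idem (q i) ⟩
    q i                 ≡⟨ sym (∧-identityʳ (q i)) ⟩
    q i ∧ true          ∎

⌊≟⌋-sym : (i j : Fin n) → ⌊ i ≟ j ⌋ ≡ ⌊ j ≟ i ⌋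
⌊≟⌋-sym i j with i ≟ j | j ≟ i
... | yes _   | yes _   = refl
... | no  _   | no  _   = refl
... | yes i≡j | no  j≢i = contradiction (sym i≡j) j≢i
... | no  i≢j | yes j≡i = contradiction (sym j≡i) i≢j

N-symmetric : (H : Graph n) → IsSymmetric (N H)
N-symmetric H i j = cong₂ _∨_ (⌊≟⌋-sym i j) (Graph.sym H i j)

N-diagonal : (H : Graph n) (i : Fin n) → N H i i ≡ true
N-diagonal H i = cong (_∨ adj H i i) (trans (isYes≗does (i ≟ i)) (dec-true (i ≟ i) refl))

solves-adjoint : (H : Graph n) {q x p c : Vec₂ n} → Solves H q x → Solves H p c → x · p ≡ q · c
solves-adjoint H {q} {x} {p} {c} q↦x p↦c = begin
  x · p            ≡⟨ ·-cong (sym ∘ q↦x) (λ _ → refl) ⟩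
  (N H ⊛ q) · p    ≡⟨ ⊛-adjoint (N H) (N-symmetric H) q p ⟩
  q · (N H ⊛ p)    ≡⟨ ·-cong (λ _ → refl) p↦c ⟩
  q · c            ∎

solves-self : (H : Graph n) {q x : Vec₂ n} → Solves H q x → q · x ≡ q · 𝟏
solves-self H {q} q↦x =
  trans (·-cong (λ _ → refl) (sym ∘ q↦x)) (·-⊛-self (N H) (N-symmetric H) (N-diagonal H) q)

solves-resp-≗ : (H : Graph n) {p c c′ : Vec₂ n} → c ≗ c′ → Solves H p c ⇔ Solves H p c′
solves-resp-≗ H c≗c′ = mk⇔ (λ h i → trans (h i) (c≗c′ i)) (λ h i → trans (h i) (sym (c≗c′ i)))

module _ (G : Graph n) (A₁ A₂ : Vec₂ n) (d : Disjoint A₁ A₂) where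

  N-toggle : ∀ i j → N (toggle G A₁ A₂ d) i j ≡ (N G ⊞ (A₁ ⊗ A₂ ⊞ A₂ ⊗ A₁)) i j
  N-toggle i j with i ≟ j
  ... | yes refl = cong not (sym (xor-swapped-self (A₁ i) (A₂ i)))
  ... | no  _    = cong (adj G i j xor_) (∨≡xor (A₁ i ∧ A₂ j) (A₂ i ∧ A₁ j) disjoint)
    where
    disjoint : (A₁ i ∧ A₂ j) ∧ (A₂ i ∧ A₁ j) ≡ false
    disjoint = trans (interchange (A₁ i) (A₂ j) (A₂ i) (A₁ j)) (cong (_∧ (A₂ j ∧ A₁ j)) (d i))

  N-toggle-⊛ : (p : Vec₂ n) → N (toggle G A₁ A₂ d) ⊛ p ≗ N G ⊛ p ⊕ ((A₂ · p) *ᵥ A₁ ⊕ (A₁ · p) *ᵥ A₂)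
  N-toggle-⊛ p i = begin
    (N (toggle G A₁ A₂ d) ⊛ p) i
      ≡⟨ ⊛-congˡ N-toggle p i ⟩
    ((N G ⊞ (A₁ ⊗ A₂ ⊞ A₂ ⊗ A₁)) ⊛ p) i
      ≡⟨ ⊞-⊛ (N G) (A₁ ⊗ A₂ ⊞ A₂ ⊗ A₁) p i ⟩
    (N G ⊛ p) i xor ((A₁ ⊗ A₂ ⊞ A₂ ⊗ A₁) ⊛ p) i
      ≡⟨ cong ((N G ⊛ p) i xor_) (⊞-⊛ (A₁ ⊗ A₂) (A₂ ⊗ A₁) p i) ⟩
    (N G ⊛ p) i xor (((A₁ ⊗ A₂) ⊛ p) i xor ((A₂ ⊗ A₁) ⊛ p) i)
      ≡⟨ cong ((N G ⊛ p) i xor_) (cong₂ _xor_ (⊗-⊛ A₁ A₂ p i) (⊗-⊛ A₂ A₁ p i)) ⟩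
    (N G ⊛ p) i xor (((A₂ · p) ∧ A₁ i) xor ((A₁ · p) ∧ A₂ i))
      ∎

  solves-toggle⇔ : {p c : Vec₂ n} →
    Solves (toggle G A₁ A₂ d) p c ⇔ Solves G p (c ⊕ ((A₂ · p) *ᵥ A₁ ⊕ (A₁ · p) *ᵥ A₂))
  solves-toggle⇔ {p} {c} = mk⇔
    (λ h i → xor-moveʳ (trans (sym (N-toggle-⊛ p i)) (h i)))
    (λ h i → trans (N-toggle-⊛ p i) (trans (cong (_xor _) (h i)) (xor-cancelʳ (c i) _)))

module Transfer (G : Graph n) {A₁ A₂ : Vec₂ n} (d : Disjoint A₁ A₂) {q₁ q₂ : Vec₂ n}
  (q₁↦A₁ : Solves G q₁ A₁) (q₂↦A₂ : Solves G q₂ A₂)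
  (q₁·A₁≡0 : q₁ · A₁ ≡ false) (q₂·A₁≡0 : q₂ · A₁ ≡ false) (q₂·A₂≡1 : q₂ · A₂ ≡ true) where

  G* : Graph n
  G* = toggle G A₁ A₂ d

  q₁·A₂≡0 : q₁ · A₂ ≡ false
  q₁·A₂≡0 = trans (sym (solves-adjoint G q₁↦A₁ q₂↦A₂)) (trans (·-comm A₁ q₂) q₂·A₁≡0)

  A₁-coordinate : ∀ {p c} β α → Solves G p (c ⊕ (β *ᵥ A₁ ⊕ α *ᵥ A₂)) → A₁ · p ≡ q₁ · c
  A₁-coordinate {p} {c} β α h = begin
    A₁ · p
      ≡⟨ solves-adjoint G q₁↦A₁ h ⟩
    q₁ · (c ⊕ (β *ᵥ A₁ ⊕ α *ᵥ A₂))
      ≡⟨ ·-linear q₁ c β A₁ α A₂ ⟩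
    (q₁ · c) xor ((β ∧ (q₁ · A₁)) xor (α ∧ (q₁ · A₂)))
      ≡⟨ cong₂ (λ u v → (q₁ · c) xor ((β ∧ u) xor (α ∧ v))) q₁·A₁≡0 q₁·A₂≡0 ⟩
    (q₁ · c) xor ((β ∧ false) xor (α ∧ false))
      ≡⟨ cong ((q₁ · c) xor_) (cong₂ _xor_ (∧-zeroʳ β) (∧-zeroʳ α)) ⟩
    (q₁ · c) xor false
      ≡⟨ xor-identityʳ (q₁ · c) ⟩
    q₁ · c
      ∎

  A₂-coordinate : ∀ {p c} β α → Solves G p (c ⊕ (β *ᵥ A₁ ⊕ α *ᵥ A₂)) → A₂ · p ≡ (q₂ · c) xor α
  A₂-coordinate {p} {c} β α h = begin
    A₂ · p
      ≡⟨ solves-adjoint G q₂↦A₂ h ⟩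
    q₂ · (c ⊕ (β *ᵥ A₁ ⊕ α *ᵥ A₂))
      ≡⟨ ·-linear q₂ c β A₁ α A₂ ⟩
    (q₂ · c) xor ((β ∧ (q₂ · A₁)) xor (α ∧ (q₂ · A₂)))
      ≡⟨ cong₂ (λ u v → (q₂ · c) xor ((β ∧ u) xor (α ∧ v))) q₂·A₁≡0 q₂·A₂≡1 ⟩
    (q₂ · c) xor ((β ∧ false) xor (α ∧ true))
      ≡⟨ cong ((q₂ · c) xor_) (cong₂ _xor_ (∧-zeroʳ β) (∧-identityʳ α)) ⟩
    (q₂ · c) xor α
      ∎

  solves-toggle⇔shifted : ∀ {p c β} → q₁ · c ≡ false → q₂ · c ≡ β →
                          Solves G* p c ⇔ Solves G p (c ⊕ β *ᵥ A₁)
  solves-toggle⇔shifted {p} {c} {β} q₁·c≡0 q₂·c≡β = mk⇔ forward backward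
    where
    Shifted : Bool → Bool → Set
    Shifted b a = Solves G p (c ⊕ (b *ᵥ A₁ ⊕ a *ᵥ A₂))

    drop-A₂ : Shifted β false ⇔ Solves G p (c ⊕ β *ᵥ A₁)
    drop-A₂ = solves-resp-≗ G (λ i → cong (c i xor_) (xor-identityʳ (β ∧ A₁ i)))

    coordinate₁ : ∀ b a → Shifted b a → A₁ · p ≡ false
    coordinate₁ b a h = trans (A₁-coordinate b a h) q₁·c≡0

    coordinate₂ : ∀ b a → Shifted b a → A₂ · p ≡ β xor a
    coordinate₂ b a h = trans (A₂-coordinate b a h) (cong (_xor a) q₂·c≡β)

    forward : Solves G* p c → Solves G p (c ⊕ β *ᵥ A₁)
    forward h* = to drop-A₂ (subst₂ Shifted A₂·p≡β A₁·p≡0 h)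
      where
      h : Shifted (A₂ · p) (A₁ · p)
      h = to (solves-toggle⇔ G A₁ A₂ d) h*
      A₁·p≡0 : A₁ · p ≡ false
      A₁·p≡0 = coordinate₁ (A₂ · p) (A₁ · p) h
      A₂·p≡β : A₂ · p ≡ β
      A₂·p≡β = trans (coordinate₂ (A₂ · p) (A₁ · p) h)
                     (trans (cong (β xor_) A₁·p≡0) (xor-identityʳ β))

    backward : Solves G p (c ⊕ β *ᵥ A₁) → Solves G* p c
    backward h′ =
      from (solves-toggle⇔ G A₁ A₂ d) (subst₂ Shifted (sym A₂·p≡β) (sym (coordinate₁ β false h)) h)
      where
      h : Shifted β false
      h = from drop-A₂ h′
      A₂·p≡β : A₂ · p ≡ β
      A₂·p≡β = trans (coordinate₂ β false h) (xor-identityʳ β)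

  solves-A₁ : Solves G* q₁ A₁
  solves-A₁ = from (solves-toggle⇔shifted q₁·A₁≡0 q₂·A₁≡0)
                   (λ i → trans (q₁↦A₁ i) (sym (xor-identityʳ (A₁ i))))

  solves-A₂ : Solves G* (q₂ ⊕ q₁) A₂
  solves-A₂ = from (solves-toggle⇔shifted q₁·A₂≡0 q₂·A₂≡1)
                   (λ i → trans (⊛-distribˡ-⊕ (N G) q₂ q₁ i) (cong₂ _xor_ (q₂↦A₂ i) (q₁↦A₁ i)))

  kernel⇔ : {p : Vec₂ n} → Solves G* p 𝟎 ⇔ Solves G p 𝟎
  kernel⇔ = solves-toggle⇔shifted (·-zeroʳ q₁) (·-zeroʳ q₂)

isZero⇔≗𝟎 : (v : Vec₂ n) → isZero v ≡ true ⇔ v ≗ 𝟎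
isZero⇔≗𝟎 {zero}  v = mk⇔ (λ _ ()) (λ _ → refl)
isZero⇔≗𝟎 {suc n} v with v zero in v₀
... | false = mk⇔ (λ h → λ { zero → v₀ ; (suc i) → to (isZero⇔≗𝟎 (v ∘ suc)) h i })
                  (λ h → from (isZero⇔≗𝟎 (v ∘ suc)) (h ∘ suc))
... | true  = mk⇔ (λ ()) (λ h → contradiction (trans (sym v₀) (h zero)) λ ())

allVecs-cong : ∀ n {f g : Vec₂ n → ℕ} → (∀ v → f v ≡ g v) → allVecs n f ≡ allVecs n g
allVecs-cong zero    f≡g = f≡g _
allVecs-cong (suc n) f≡g = cong₂ _+_ (allVecs-cong n (λ v → f≡g _)) (allVecs-cong n (λ v → f≡g _))

ν-cong : (H H′ : Graph n) → (∀ p → Solves H p 𝟎 ⇔ Solves H′ p 𝟎) → ν H ≡ ν H′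
ν-cong {n} H H′ same-kernel =
  cong ⌊log₂_⌋ (allVecs-cong n (λ p → cong (λ b → if b then 1 else 0) (isZero-same p)))
  where
  isZero-same : ∀ p → isZero (N H ⊛ p) ≡ isZero (N H′ ⊛ p)
  isZero-same p =
    ⇔→≡ (⇔.trans (isZero⇔≗𝟎 (N H ⊛ p)) (⇔.trans (same-kernel p) (⇔.sym (isZero⇔≗𝟎 (N H′ ⊛ p)))))

mainTheorem12 : ∀ {n} (G : Graph n) (A₁ A₂ : Vec₂ n) (d : Disjoint A₁ A₂) →
    IsNO G A₁ → IsAO G A₂ → IsAO[ G ] (compl A₁) A₂ →
    (∀ (p : Vec₂ n) → Solves (toggle G A₁ A₂ d) p 𝟏 ⇔ Solves G p (compl A₁))
    × IsNO (toggle G A₁ A₂ d) A₁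
    × IsAO (toggle G A₁ A₂ d) A₂
    × ν (toggle G A₁ A₂ d) ≡ ν G
mainTheorem12 G A₁ A₂ d
  ((q₁ , q₁↦A₁) , (p₀ , p₀↦𝟏) , NO₁) ((q₂ , q₂↦A₂) , _ , AO₂) (_ , (p₁ , p₁↦Ā₁) , AO₂[Ā₁]) =
    solves-𝟏
  , ((q₁ , solves-A₁) , 𝟏-solvable , λ p p↦𝟏 → trans (solves-adjoint G* solves-A₁ p↦𝟏) q₁·𝟏≡0)
  , ((q₂ ⊕ q₁ , solves-A₂) , 𝟏-solvable , λ p p↦𝟏 → AO₂[Ā₁] p (to (solves-𝟏 p) p↦𝟏))
  , ν-cong G* G (λ _ → kernel⇔)
  where
  q₁·𝟏≡0 : q₁ · 𝟏 ≡ false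
  q₁·𝟏≡0 = trans (sym (solves-adjoint G q₁↦A₁ p₀↦𝟏)) (NO₁ p₀ p₀↦𝟏)
  q₂·𝟏≡1 : q₂ · 𝟏 ≡ true
  q₂·𝟏≡1 = trans (sym (solves-adjoint G q₂↦A₂ p₀↦𝟏)) (AO₂ p₀ p₀↦𝟏)
  q₂·A₁≡0 : q₂ · A₁ ≡ false
  q₂·A₁≡0 = not-injective (begin
    true xor (q₂ · A₁)       ≡⟨ xor-comm true (q₂ · A₁) ⟩
    (q₂ · A₁) xor true       ≡⟨ cong ((q₂ · A₁) xor_) (sym q₂·𝟏≡1) ⟩
    (q₂ · A₁) xor (q₂ · 𝟏)   ≡⟨ sym (·-distribˡ-⊕ q₂ A₁ 𝟏) ⟩
    q₂ · compl A₁            ≡⟨ sym (solves-adjoint G q₂↦A₂ p₁↦Ā₁) ⟩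
    A₂ · p₁                  ≡⟨ AO₂[Ā₁] p₁ p₁↦Ā₁ ⟩
    true                     ∎)
  open Transfer G d q₁↦A₁ q₂↦A₂
    (trans (solves-self G q₁↦A₁) q₁·𝟏≡0) q₂·A₁≡0 (trans (solves-self G q₂↦A₂) q₂·𝟏≡1)
  solves-𝟏 : ∀ p → Solves G* p 𝟏 ⇔ Solves G p (compl A₁)
  solves-𝟏 p =
    ⇔.trans (solves-toggle⇔shifted q₁·𝟏≡0 q₂·𝟏≡1) (solves-resp-≗ G (λ i → xor-comm true (A₁ i)))
  𝟏-solvable : Solvable G* 𝟏
  𝟏-solvable = p₁ , from (solves-𝟏 p₁) p₁↦Ā₁
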